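{- Let $n\ge1$ be an integer, $V=\{u\in\mathbb{Z}^3:\ \sum_{i=1}^3|u_i|=n\}$ and $E'=\{\{v,w\}\subset V:\ v\neq w,\ |v_i-w_i|\le 1 \text{ for all } 1\le i\le 3\}$. Then $|E'|=12n^2$.
   Context: $G'_n=(V,E')$ is called the $n$-octahedral graph (an undirected graph). -}

module Defs where

open import Data.Nat using (ℕ)
open import Data.Integer using (ℤ; ∣_∣; _-_; _+_; _<_)
import Data.Nat as ℕ
open import Data.Product using (Σ; _×_)
open import Data.Sum using (_⊎_)
open import Relation.Binary.PropositionalEquality using (_≡_)

ℤ³ : Set
ℤ³ = ℤ × ℤ × ℤ

open import Data.Product using (_,_)

norm1 : ℤ³ → ℕ
norm1 (a , b , c) = ∣ a ∣ ℕ.+ ∣ b ∣ ℕ.+ ∣ c ∣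

InV : ℕ → ℤ³ → Set
InV n u = norm1 u ≡ n

Close : ℤ³ → ℤ³ → Set
Close (a , b , c) (a' , b' , c') =
  (∣ a - a' ∣ ℕ.≤ 1) × (∣ b - b' ∣ ℕ.≤ 1) × (∣ c - c' ∣ ℕ.≤ 1)

-- strict lexicographic order on ℤ³, used to represent each unordered pair
-- {v,w} with v ≠ w uniquely as the ordered pair (v,w) with v <lex w
_<lex_ : ℤ³ → ℤ³ → Set
(a , b , c) <lex (a' , b' , c') =
  (a < a') ⊎ ((a ≡ a') × ((b < b') ⊎ ((b ≡ b') × (c < c'))))

Edge : ℕ → Set
Edge n = Σ ℤ³ λ v → Σ ℤ³ λ w →
  InV n v × InV n w × (v <lex w) × Close v w

module Submission where

-- Two points v, w of the sphere V = {u ∈ ℤ³ : ‖u‖₁ = n} are adjacent exactly when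
-- w = v + δ for a displacement δ ∈ {-1,0,1}³.  The parity of ‖u‖₁ is the sum of the
-- parities of the coordinates, so δ must change an even number of coordinates; since
-- each edge is recorded with its lexicographically smaller endpoint first, δ is one of
-- the six directions e₁ ± e₂, e₁ ± e₃, e₂ ± e₃.  Signed coordinate permutations preserve
-- ‖·‖₁ and permute these directions, so each direction carries as many edges as e₁ − e₂.
-- Finally v and v + e₁ − e₂ both lie on the sphere iff v₁ ≥ 0 < v₂ or v₁ < 0 ≥ v₂; each
-- case is parametrised by the triples (x, y, c) ∈ ℕ × ℕ × ℤ with x + y + |c| = n − 1,
-- and these are in bijection with pairs of splittings of n − 1, i.e. with Fin n × Fin n.

open import Defs
open import Data.Nat using (ℕ; _*_; _≥_)
open import Data.Fin using (Fin)
open import Function.Bundles using (_↔_)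

open import Axiom.UniquenessOfIdentityProofs.WithK using (uip)
import Algebra.Properties.CommutativeSemigroup as CommutativeSemigroupProperties
open import Data.Empty using (⊥; ⊥-elim)
open import Data.Fin using (fromℕ<; toℕ)
open import Data.Fin.Patterns using (0F; 1F; 2F; 3F; 4F; 5F)
import Data.Fin.Properties as FinP
open import Data.Integer as ℤ using (ℤ; +_; -[1+_]; ∣_∣; _-_; _+_; -_; -<-; -<+; +<+)
import Data.Integer.Properties as ℤP
open import Data.Integer.Tactic.RingSolver using (solve-∀)
open import Data.Nat as ℕ using (zero; suc; z≤n; s≤s)
import Data.Nat.Properties as ℕP
import Data.Nat.Tactic.RingSolver as ℕSolver
open import Data.Parity.Base as ℙ using (Parity; 0ℙ; 1ℙ; _⁻¹)
import Data.Parity.Properties as ℙP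
open import Data.Product using (Σ; _×_; _,_; proj₁; proj₂)
open import Data.Product.Algebra using (Σ-assoc)
open import Data.Product.Function.Dependent.Propositional using (Σ-↔)
open import Data.Product.Function.NonDependent.Propositional using (_×-↔_)
open import Data.Sum using (_⊎_; inj₁; inj₂)
open import Data.Sum.Function.Propositional using (_⊎-↔_)
open import Function using (_∘_)
open import Function.Bundles using (Inverse; mk↔ₛ′)
open import Function.Properties.Inverse using (↔-refl; ↔-sym; ↔-trans)
import Function.Related.Propositional as Related
open import Relation.Binary.PropositionalEquality
open import Relation.Nullary using (Irrelevant)

module ℕ-comm = CommutativeSemigroupProperties ℕP.+-commutativeSemigroup

-- Unit steps on ℤ

data Step : Set where
  down stay up : Step

offset : Step → ℤ
offset down = -[1+ 0 ]
offset stay = + 0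
offset up   = + 1

-- `move s a = a + offset s`, defined by cases so that absolute values compute.
move : Step → ℤ → ℤ
move down (+ zero)    = -[1+ 0 ]
move down (+ suc n)   = + n
move down -[1+ n ]    = -[1+ suc n ]
move stay a           = a
move up (+ n)         = + suc n
move up -[1+ zero ]   = + 0
move up -[1+ suc n ]  = -[1+ n ]

move-offset : ∀ s a → move s a ≡ a + offset s
move-offset down (+ zero)    = refl
move-offset down (+ suc n)   = refl
move-offset down -[1+ n ]    = cong (λ k → -[1+ suc k ]) (sym (ℕP.+-identityʳ n))
move-offset stay a           = sym (ℤP.+-identityʳ a)
move-offset up (+ n)         = cong +_ (ℕP.+-comm 1 n)
move-offset up -[1+ zero ]   = refl
move-offset up -[1+ suc n ]  = refl

move-difference : ∀ s a → move s a - a ≡ offset s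
move-difference s a = begin
  move s a - a      ≡⟨ cong (_- a) (move-offset s a) ⟩
  a + offset s - a  ≡⟨ cancel a (offset s) ⟩
  offset s          ∎
  where
  open ≡-Reasoning
  cancel : ∀ a d → a + d - a ≡ d
  cancel = solve-∀

offset-injective : ∀ {s t} → offset s ≡ offset t → s ≡ t
offset-injective {down} {down} _ = refl
offset-injective {stay} {stay} _ = refl
offset-injective {up}   {up}   _ = refl
offset-injective {down} {stay} ()
offset-injective {down} {up}   ()
offset-injective {stay} {down} ()
offset-injective {stay} {up}   ()
offset-injective {up}   {down} ()
offset-injective {up}   {stay} ()

move-injective : ∀ {s t} a → move s a ≡ move t a → s ≡ t
move-injective {s} {t} a eq = offset-injective (begin
  offset s      ≡⟨ sym (move-difference s a) ⟩
  move s a - a  ≡⟨ cong (_- a) eq ⟩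
  move t a - a  ≡⟨ move-difference t a ⟩
  offset t      ∎)
  where open ≡-Reasoning

unit-offset : ∀ d → ∣ d ∣ ℕ.≤ 1 → Σ Step λ s → d ≡ offset s
unit-offset (+ zero)         _        = stay , refl
unit-offset (+ suc zero)     _        = up , refl
unit-offset -[1+ zero ]      _        = down , refl
unit-offset (+ suc (suc n))  (s≤s ())
unit-offset -[1+ suc n ]     (s≤s ())

close⇒step : ∀ a b → ∣ a - b ∣ ℕ.≤ 1 → Σ Step λ s → b ≡ move s a
close⇒step a b close with unit-offset (b - a) (subst (ℕ._≤ 1) (ℤP.∣i-j∣≡∣j-i∣ a b) close)
... | s , b-a≡offset = s , (begin
  b             ≡⟨ split a b ⟩
  a + (b - a)   ≡⟨ cong (λ d → a + d) b-a≡offset ⟩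
  a + offset s  ≡⟨ sym (move-offset s a) ⟩
  move s a      ∎)
  where
  open ≡-Reasoning
  split : ∀ a b → b ≡ a + (b - a)
  split = solve-∀

-- Kept abstract: only the statement is ever used, and unfolding the proof term
-- inside later goals makes type checking very slow.
abstract
  step⇒close : ∀ s a → ∣ a - move s a ∣ ℕ.≤ 1
  step⇒close s a = subst (ℕ._≤ 1) (sym distance) (unit s)
    where
    distance : ∣ a - move s a ∣ ≡ ∣ offset s ∣
    distance = trans (ℤP.∣i-j∣≡∣j-i∣ a (move s a)) (cong ∣_∣ (move-difference s a))
    unit : ∀ s → ∣ offset s ∣ ℕ.≤ 1
    unit down = s≤s z≤n
    unit stay = z≤n
    unit up   = s≤s z≤n

<move-up : ∀ a → a ℤ.< move up a
<move-up (+ n)          = +<+ (ℕP.n<1+n n)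
<move-up -[1+ zero ]    = -<+
<move-up -[1+ suc n ]   = -<- (ℕP.n<1+n n)

move-down< : ∀ a → move down a ℤ.< a
move-down< (+ zero)   = -<+
move-down< (+ suc n)  = +<+ (ℕP.n<1+n n)
move-down< -[1+ n ]   = -<- (ℕP.n<1+n n)

<move⇒up : ∀ {s} a → a ℤ.< move s a → s ≡ up
<move⇒up {down} a a<a' = ⊥-elim (ℤP.<-asym a<a' (move-down< a))
<move⇒up {stay} a a<a  = ⊥-elim (ℤP.<-irrefl refl a<a)
<move⇒up {up}   a _    = refl

≡move⇒stay : ∀ {s} a → a ≡ move s a → s ≡ stay
≡move⇒stay a eq = sym (move-injective a eq)

stepParity : Step → Parity
stepParity stay = 0ℙ
stepParity down = 1ℙ
stepParity up   = 1ℙ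

parity-suc : ∀ n → ℕ.parity (suc n) ≡ ℕ.parity n ⁻¹
parity-suc n = trans (sym (ℙP.⁻¹-involutive _)) (cong _⁻¹ (ℙP.suc-homo-⁻¹ n))

-- A non-trivial step changes |a| by one, hence flips its parity.
parity-move : ∀ s a → ℕ.parity ∣ move s a ∣ ≡ stepParity s ℙ.+ ℕ.parity ∣ a ∣
parity-move down (+ zero)    = refl
parity-move down (+ suc n)   = sym (ℙP.suc-homo-⁻¹ n)
parity-move down -[1+ n ]    = sym (ℙP.suc-homo-⁻¹ n)
parity-move stay a           = refl
parity-move up (+ n)         = parity-suc n
parity-move up -[1+ zero ]   = refl
parity-move up -[1+ suc n ]  = parity-suc n

reverse : Step → Step
reverse down = up
reverse stay = stay
reverse up   = down

move-neg : ∀ s a → move (reverse s) (- a) ≡ - move s a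
move-neg down (+ zero)         = refl
move-neg down (+ suc zero)     = refl
move-neg down (+ suc (suc n))  = refl
move-neg down -[1+ n ]         = refl
move-neg stay a                = refl
move-neg up (+ zero)           = refl
move-neg up (+ suc n)          = refl
move-neg up -[1+ zero ]        = refl
move-neg up -[1+ suc n ]       = refl

-- Displacements of ℤ³

Δ : Set
Δ = Step × Step × Step

displace : Δ → ℤ³ → ℤ³
displace (s , t , u) (a , b , c) = move s a , move t b , move u c

-- The points close to v (in the sense of E') are exactly its displacements.
-- Kept abstract for the same reason as step⇒close.
abstract
  close⇒displace : ∀ v w → Close v w → Σ Δ λ δ → w ≡ displace δ v
  close⇒displace (a , b , c) (a' , b' , c') (a~a' , b~b' , c~c')
    with close⇒step a a' a~a' | close⇒step b b' b~b' | close⇒step c c' c~c'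
  ... | s , refl | t , refl | u , refl = (s , t , u) , refl

displace⇒close : ∀ δ v → Close v (displace δ v)
displace⇒close (s , t , u) (a , b , c) = step⇒close s a , step⇒close t b , step⇒close u c

displace-injective : ∀ {δ δ'} v → displace δ v ≡ displace δ' v → δ ≡ δ'
displace-injective (a , b , c) eq =
  cong₂ _,_ (move-injective a (cong proj₁ eq))
    (cong₂ _,_ (move-injective b (cong (proj₁ ∘ proj₂) eq)) (move-injective c (cong (proj₂ ∘ proj₂) eq)))

close⇒displace-displace : ∀ δ v (v~w : Close v (displace δ v)) →
  close⇒displace v (displace δ v) v~w ≡ (δ , refl)
close⇒displace-displace δ v v~w with close⇒displace v (displace δ v) v~w
... | δ' , eq with displace-injective v eq
... | refl = cong (δ ,_) (uip eq refl)

data Positive : Δ → Set where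
  first  : ∀ {t u} → Positive (up , t , u)
  second : ∀ {u} → Positive (stay , up , u)
  third  : Positive (stay , stay , up)

lex-step : ∀ {s} {X : Set} a → (a ℤ.< move s a) ⊎ ((a ≡ move s a) × X) → (s ≡ up) ⊎ ((s ≡ stay) × X)
lex-step a (inj₁ a<a')       = inj₁ (<move⇒up a a<a')
lex-step a (inj₂ (a≡a' , x)) = inj₂ (≡move⇒stay a a≡a' , x)

lex⇒positive : ∀ δ v → v <lex displace δ v → Positive δ
lex⇒positive (s , t , u) (a , b , c) v<w with lex-step a v<w
... | inj₁ refl = first
... | inj₂ (refl , b≤b') with lex-step b b≤b'
...   | inj₁ refl = second
...   | inj₂ (refl , c<c') with <move⇒up c c<c'
...     | refl = third

positive⇒lex : ∀ {δ} v → Positive δ → v <lex displace δ v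
positive⇒lex (a , b , c) first  = inj₁ (<move-up a)
positive⇒lex (a , b , c) second = inj₂ (refl , inj₁ (<move-up b))
positive⇒lex (a , b , c) third  = inj₂ (refl , inj₂ (refl , <move-up c))

displacementParity : Δ → Parity
displacementParity (s , t , u) = stepParity s ℙ.+ stepParity t ℙ.+ stepParity u

parity-norm : ∀ a b c →
  ℕ.parity (norm1 (a , b , c)) ≡ ℕ.parity ∣ a ∣ ℙ.+ ℕ.parity ∣ b ∣ ℙ.+ ℕ.parity ∣ c ∣
parity-norm a b c = trans (ℙP.+-homo-+ (∣ a ∣ ℕ.+ ∣ b ∣) ∣ c ∣)
  (cong (ℙ._+ ℕ.parity ∣ c ∣) (ℙP.+-homo-+ ∣ a ∣ ∣ b ∣))

parity-displace : ∀ δ v →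
  ℕ.parity (norm1 (displace δ v)) ≡ displacementParity δ ℙ.+ ℕ.parity (norm1 v)
parity-displace (s , t , u) (a , b , c) = begin
  ℕ.parity (norm1 (move s a , move t b , move u c))
    ≡⟨ parity-norm (move s a) (move t b) (move u c) ⟩
  ℕ.parity ∣ move s a ∣ ℙ.+ ℕ.parity ∣ move t b ∣ ℙ.+ ℕ.parity ∣ move u c ∣
    ≡⟨ cong₂ ℙ._+_ (cong₂ ℙ._+_ (parity-move s a) (parity-move t b)) (parity-move u c) ⟩
  (δ₁ ℙ.+ p₁) ℙ.+ (δ₂ ℙ.+ p₂) ℙ.+ (δ₃ ℙ.+ p₃)
    ≡⟨ cong (ℙ._+ (δ₃ ℙ.+ p₃)) (interchange δ₁ p₁ δ₂ p₂) ⟩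
  (δ₁ ℙ.+ δ₂) ℙ.+ (p₁ ℙ.+ p₂) ℙ.+ (δ₃ ℙ.+ p₃)
    ≡⟨ interchange (δ₁ ℙ.+ δ₂) (p₁ ℙ.+ p₂) δ₃ p₃ ⟩
  displacementParity (s , t , u) ℙ.+ (p₁ ℙ.+ p₂ ℙ.+ p₃)
    ≡⟨ cong (displacementParity (s , t , u) ℙ.+_) (sym (parity-norm a b c)) ⟩
  displacementParity (s , t , u) ℙ.+ ℕ.parity (norm1 (a , b , c))
    ∎
  where
  open ≡-Reasoning
  open CommutativeSemigroupProperties ℙP.+-commutativeSemigroup using (interchange)
  δ₁ = stepParity s
  δ₂ = stepParity t
  δ₃ = stepParity u
  p₁ = ℕ.parity ∣ a ∣
  p₂ = ℕ.parity ∣ b ∣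
  p₃ = ℕ.parity ∣ c ∣

even-displacement : ∀ δ v → norm1 (displace δ v) ≡ norm1 v → displacementParity δ ≡ 0ℙ
even-displacement δ v same-norm = ℙP.+-cancelʳ-≡ (ℕ.parity (norm1 v)) (displacementParity δ) 0ℙ (begin
  displacementParity δ ℙ.+ ℕ.parity (norm1 v)  ≡⟨ sym (parity-displace δ v) ⟩
  ℕ.parity (norm1 (displace δ v))              ≡⟨ cong ℕ.parity same-norm ⟩
  ℕ.parity (norm1 v)                           ∎)
  where open ≡-Reasoning

-- Edges as displacements

Link : ℕ → Δ → Set
Link n δ = Σ ℤ³ λ v → InV n v × InV n (displace δ v)

-- The displacements that can point from an edge's smaller endpoint to its larger one.
Admissible : Δ → Set
Admissible δ = Positive δ × (displacementParity δ ≡ 0ℙ)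

-- The side conditions of an edge are propositions, so an edge is determined by its endpoints.
lex-irrelevant : ∀ {a b : ℤ} {X : Set} → Irrelevant X → Irrelevant ((a ℤ.< b) ⊎ ((a ≡ b) × X))
lex-irrelevant _ (inj₁ p) (inj₁ q)        = cong inj₁ (ℤP.<-irrelevant p q)
lex-irrelevant _ (inj₁ p) (inj₂ (e , _))  = ⊥-elim (ℤP.<⇒≢ p e)
lex-irrelevant _ (inj₂ (e , _)) (inj₁ q)  = ⊥-elim (ℤP.<⇒≢ q e)
lex-irrelevant X-irrelevant (inj₂ (e , x)) (inj₂ (e' , x')) =
  cong₂ (λ e x → inj₂ (e , x)) (uip e e') (X-irrelevant x x')

<lex-irrelevant : ∀ v w → Irrelevant (v <lex w)
<lex-irrelevant (a , b , c) (a' , b' , c') = lex-irrelevant (lex-irrelevant ℤP.<-irrelevant)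

Close-irrelevant : ∀ v w → Irrelevant (Close v w)
Close-irrelevant (a , b , c) (a' , b' , c') (p₁ , p₂ , p₃) (q₁ , q₂ , q₃) =
  cong₂ _,_ (ℕP.≤-irrelevant p₁ q₁) (cong₂ _,_ (ℕP.≤-irrelevant p₂ q₂) (ℕP.≤-irrelevant p₃ q₃))

Positive-irrelevant : ∀ {δ} → Irrelevant (Positive δ)
Positive-irrelevant first  first  = refl
Positive-irrelevant second second = refl
Positive-irrelevant third  third  = refl

edges↔displacements : ∀ {n} → Edge n ↔ (Σ Δ λ δ → Admissible δ × Link n δ)
edges↔displacements {n} = mk↔ₛ′ to from to∘from from∘to
  where
  to : Edge n → Σ Δ λ δ → Admissible δ × Link n δ
  to (v , w , v∈V , w∈V , v<w , v~w) with close⇒displace v w v~w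
  ... | δ , refl =
    δ , (lex⇒positive δ v v<w , even-displacement δ v (trans w∈V (sym v∈V))) , v , v∈V , w∈V

  from : (Σ Δ λ δ → Admissible δ × Link n δ) → Edge n
  from (δ , (positive , _) , v , v∈V , w∈V) =
    v , displace δ v , v∈V , w∈V , positive⇒lex v positive , displace⇒close δ v

  to∘from : ∀ x → to (from x) ≡ x
  to∘from (δ , (positive , even) , v , v∈V , w∈V)
    with close⇒displace v (displace δ v) (displace⇒close δ v)
       | close⇒displace-displace δ v (displace⇒close δ v)
  ... | _ | refl = cong₂ (λ positive even → δ , (positive , even) , v , v∈V , w∈V)
    (Positive-irrelevant _ positive) (uip _ even)

  from∘to : ∀ e → from (to e) ≡ e
  from∘to (v , w , v∈V , w∈V , v<w , v~w) with close⇒displace v w v~w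
  ... | δ , refl = cong₂ (λ lt cl → v , displace δ v , v∈V , w∈V , lt , cl)
    (<lex-irrelevant v (displace δ v) _ v<w) (Close-irrelevant v (displace δ v) _ v~w)

-- The six directions

direction : Fin 6 → Σ Δ Admissible
direction 0F = (up , down , stay) , first , refl
direction 1F = (up , up , stay) , first , refl
direction 2F = (up , stay , down) , first , refl
direction 3F = (up , stay , up) , first , refl
direction 4F = (stay , up , down) , second , refl
direction 5F = (stay , up , up) , second , refl

vector : Fin 6 → Δ
vector d = proj₁ (direction d)

-- There are no other admissible displacements: the remaining 21 are either not
-- positive or change an odd number of coordinates.
directions : Fin 6 ↔ Σ Δ Admissible
directions = mk↔ₛ′ direction index direction∘index index∘direction
  where
  index : Σ Δ Admissible → Fin 6
  index ((up , down , stay) , _) = 0F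
  index ((up , up , stay) , _)   = 1F
  index ((up , stay , down) , _) = 2F
  index ((up , stay , up) , _)   = 3F
  index ((stay , up , down) , _) = 4F
  index ((stay , up , up) , _)   = 5F
  index ((down , _ , _) , () , _)
  index ((stay , down , _) , () , _)
  index ((stay , stay , _) , third , ())
  index ((stay , up , stay) , _ , ())
  index ((up , stay , stay) , _ , ())
  index ((up , down , down) , _ , ())
  index ((up , down , up) , _ , ())
  index ((up , up , down) , _ , ())
  index ((up , up , up) , _ , ())

  direction∘index : ∀ x → direction (index x) ≡ x
  direction∘index ((up , down , stay) , first , refl)  = refl
  direction∘index ((up , up , stay) , first , refl)    = refl
  direction∘index ((up , stay , down) , first , refl)  = refl
  direction∘index ((up , stay , up) , first , refl)    = refl
  direction∘index ((stay , up , down) , second , refl) = refl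
  direction∘index ((stay , up , up) , second , refl)   = refl
  direction∘index ((down , _ , _) , () , _)
  direction∘index ((stay , down , _) , () , _)
  direction∘index ((stay , stay , _) , third , ())
  direction∘index ((stay , up , stay) , _ , ())
  direction∘index ((up , stay , stay) , _ , ())
  direction∘index ((up , down , down) , _ , ())
  direction∘index ((up , down , up) , _ , ())
  direction∘index ((up , up , down) , _ , ())
  direction∘index ((up , up , up) , _ , ())

  index∘direction : ∀ d → index (direction d) ≡ d
  index∘direction 0F = refl
  index∘direction 1F = refl
  index∘direction 2F = refl
  index∘direction 3F = refl
  index∘direction 4F = refl
  index∘direction 5F = refl

-- Symmetries

≡-congˡ-↔ : ∀ {a b n : ℕ} → a ≡ b → (a ≡ n) ↔ (b ≡ n)
≡-congˡ-↔ refl = ↔-refl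

link-transport : ∀ {n δ δ'} (σ : ℤ³ ↔ ℤ³) →
  (∀ v → norm1 (Inverse.to σ v) ≡ norm1 v) →
  (∀ v → Inverse.to σ (displace δ v) ≡ displace δ' (Inverse.to σ v)) →
  Link n δ ↔ Link n δ'
link-transport {n} {δ} {δ'} σ isometry equivariant =
  Σ-↔ σ (λ {v} → ≡-congˡ-↔ (sym (isometry v)) ×-↔ ≡-congˡ-↔ (displaced v))
  where
  displaced : ∀ v → norm1 (displace δ v) ≡ norm1 (displace δ' (Inverse.to σ v))
  displaced v = trans (sym (isometry (displace δ v))) (cong norm1 (equivariant v))

swap₂₃ : ℤ³ ↔ ℤ³
swap₂₃ = mk↔ₛ′ swap swap (λ _ → refl) (λ _ → refl)
  where
  swap : ℤ³ → ℤ³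
  swap (a , b , c) = a , c , b

rotate : ℤ³ ↔ ℤ³
rotate = mk↔ₛ′ (λ { (a , b , c) → c , a , b }) (λ { (a , b , c) → b , c , a }) (λ _ → refl) (λ _ → refl)

negate₂ : ℤ³ ↔ ℤ³
negate₂ = mk↔ₛ′ negate negate involutive involutive
  where
  negate : ℤ³ → ℤ³
  negate (a , b , c) = a , - b , c
  involutive : ∀ v → negate (negate v) ≡ v
  involutive (a , b , c) = cong (λ b → a , b , c) (ℤP.neg-involutive b)

link-swap₂₃ : ∀ {n} s t u → Link n (s , t , u) ↔ Link n (s , u , t)
link-swap₂₃ s t u = link-transport {δ = s , t , u} {δ' = s , u , t} swap₂₃
  (λ { (a , b , c) → ℕ-comm.xy∙z≈xz∙y (∣ a ∣) (∣ c ∣) (∣ b ∣) }) (λ _ → refl)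

link-rotate : ∀ {n} s t u → Link n (s , t , u) ↔ Link n (u , s , t)
link-rotate s t u = link-transport {δ = s , t , u} {δ' = u , s , t} rotate
  (λ { (a , b , c) → ℕ-comm.xy∙z≈yz∙x (∣ c ∣) (∣ a ∣) (∣ b ∣) }) (λ _ → refl)

link-negate₂ : ∀ {n} s t u → Link n (s , t , u) ↔ Link n (s , reverse t , u)
link-negate₂ s t u = link-transport {δ = s , t , u} {δ' = s , reverse t , u} negate₂
  (λ { (a , b , c) → cong (λ k → ∣ a ∣ ℕ.+ k ℕ.+ ∣ c ∣) (ℤP.∣-i∣≡∣i∣ b) })
  (λ { (a , b , c) → cong (λ k → move s a , k , move u c) (sym (move-neg t b)) })

link↔base : ∀ {n} d → Link n (vector d) ↔ Link n (vector 0F)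
link↔base 0F = ↔-refl
link↔base 1F = ↔-sym (link-negate₂ up down stay)
link↔base 2F = ↔-sym (link-swap₂₃ up down stay)
link↔base 3F = ↔-trans (link-swap₂₃ up stay up) (link↔base 1F)
link↔base 4F = ↔-sym (link-rotate up down stay)
link↔base 5F = ↔-trans (↔-sym (link-rotate up up stay)) (link↔base 1F)

-- Counting the links of direction e₁ − e₂

Triples : ℕ → Set
Triples m = Σ ℕ λ x → Σ ℕ λ y → Σ ℤ λ c → x ℕ.+ y ℕ.+ ∣ c ∣ ≡ m

∣move-up-negative∣ : ∀ x → ∣ move up -[1+ x ] ∣ ≡ x
∣move-up-negative∣ zero    = refl
∣move-up-negative∣ (suc x) = refl

two-more : ∀ x k z → suc x ℕ.+ suc k ℕ.+ z ≡ 2 ℕ.+ (x ℕ.+ k ℕ.+ z)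
two-more = ℕSolver.solve-∀

differ-by-two : ∀ {N N' k} → N' ≡ 2 ℕ.+ N → N ≡ k → N' ≡ k → ⊥
differ-by-two {N} N'≡2+N refl refl = ℕP.m≢1+n+m N {1} N'≡2+N

suc-middle : ∀ {m} x k z → x ℕ.+ k ℕ.+ z ≡ m → x ℕ.+ suc k ℕ.+ z ≡ suc m
suc-middle x k z eq = trans (cong (ℕ._+ z) (ℕP.+-suc x k)) (cong suc eq)

-- v and v + e₁ − e₂ both have norm m + 1 iff v₁ ≥ 0 < v₂ (first summand,
-- v = (x, y + 1, c)) or v₁ < 0 ≥ v₂ (second summand, v = (−1 − x, −y, c)).
base↔triples : ∀ m → Link (suc m) (vector 0F) ↔ (Triples m ⊎ Triples m)
base↔triples m = mk↔ₛ′ to from to∘from from∘to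
  where
  -- v₁ ≥ 0 ≥ v₂: the step increases the norm by two.
  rising : ∀ x k c → x ℕ.+ k ℕ.+ ∣ c ∣ ≡ suc m → suc x ℕ.+ suc k ℕ.+ ∣ c ∣ ≡ suc m → ⊥
  rising x k c = differ-by-two (two-more x k ∣ c ∣)

  -- v₁ < 0 < v₂: the step decreases the norm by two.
  falling : ∀ x y c → suc x ℕ.+ suc y ℕ.+ ∣ c ∣ ≡ suc m →
    ∣ move up -[1+ x ] ∣ ℕ.+ y ℕ.+ ∣ c ∣ ≡ suc m → ⊥
  falling x y c v∈V w∈V = differ-by-two (two-more x y ∣ c ∣)
    (trans (cong (λ k → k ℕ.+ y ℕ.+ ∣ c ∣) (sym (∣move-up-negative∣ x))) w∈V) v∈V

  to : Link (suc m) (vector 0F) → Triples m ⊎ Triples m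
  to ((+ x , + suc y , c) , v∈V , _)        =
    inj₁ (x , y , c , ℕP.suc-injective (trans (sym (suc-middle x y ∣ c ∣ refl)) v∈V))
  to ((-[1+ x ] , + zero , c) , v∈V , _)    = inj₂ (x , 0 , c , ℕP.suc-injective v∈V)
  to ((-[1+ x ] , -[1+ y ] , c) , v∈V , _)  = inj₂ (x , suc y , c , ℕP.suc-injective v∈V)
  to ((+ x , + zero , c) , v∈V , w∈V)       = ⊥-elim (rising x 0 c v∈V w∈V)
  to ((+ x , -[1+ y ] , c) , v∈V , w∈V)     = ⊥-elim (rising x (suc y) c v∈V w∈V)
  to ((-[1+ x ] , + suc y , c) , v∈V , w∈V) = ⊥-elim (falling x y c v∈V w∈V)

  w∈V : ∀ x y c → x ℕ.+ y ℕ.+ ∣ c ∣ ≡ m → ∣ move up -[1+ x ] ∣ ℕ.+ suc y ℕ.+ ∣ c ∣ ≡ suc m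
  w∈V x y c e = trans (cong (λ k → k ℕ.+ suc y ℕ.+ ∣ c ∣) (∣move-up-negative∣ x)) (suc-middle x y ∣ c ∣ e)

  from : Triples m ⊎ Triples m → Link (suc m) (vector 0F)
  from (inj₁ (x , y , c , e))     = (+ x , + suc y , c) , suc-middle x y ∣ c ∣ e , cong suc e
  from (inj₂ (x , zero , c , e))  = (-[1+ x ] , + zero , c) , cong suc e , w∈V x 0 c e
  from (inj₂ (x , suc y , c , e)) = (-[1+ x ] , -[1+ y ] , c) , cong suc e , w∈V x (suc y) c e

  to∘from : ∀ t → to (from t) ≡ t
  to∘from (inj₁ (x , y , c , e))     = cong (λ e → inj₁ (x , y , c , e)) (ℕP.≡-irrelevant _ e)
  to∘from (inj₂ (x , zero , c , e))  = cong (λ e → inj₂ (x , 0 , c , e)) (ℕP.≡-irrelevant _ e)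
  to∘from (inj₂ (x , suc y , c , e)) = cong (λ e → inj₂ (x , suc y , c , e)) (ℕP.≡-irrelevant _ e)

  same-point : ∀ v {p q p' q'} → _≡_ {A = Link (suc m) (vector 0F)} (v , p , q) (v , p' , q')
  same-point v = cong₂ (λ p q → v , p , q) (ℕP.≡-irrelevant _ _) (ℕP.≡-irrelevant _ _)

  from∘to : ∀ l → from (to l) ≡ l
  from∘to ((+ x , + suc y , c) , _ , _)         = same-point (+ x , + suc y , c)
  from∘to ((-[1+ x ] , + zero , c) , _ , _)     = same-point (-[1+ x ] , + zero , c)
  from∘to ((-[1+ x ] , -[1+ y ] , c) , _ , _)   = same-point (-[1+ x ] , -[1+ y ] , c)
  from∘to ((+ x , + zero , c) , v∈V , w∈V)       = ⊥-elim (rising x 0 c v∈V w∈V)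
  from∘to ((+ x , -[1+ y ] , c) , v∈V , w∈V)     = ⊥-elim (rising x (suc y) c v∈V w∈V)
  from∘to ((-[1+ x ] , + suc y , c) , v∈V , w∈V) = ⊥-elim (falling x y c v∈V w∈V)

Splits : ℕ → Set
Splits m = Σ ℕ λ u → Σ ℕ λ u' → u ℕ.+ u' ≡ m

same-split : ∀ {m u₁ u₁' u₂ u₂'} {p q} → u₁ ≡ u₂ → u₁' ≡ u₂' →
  _≡_ {A = Splits m} (u₁ , u₁' , p) (u₂ , u₂' , q)
same-split {u₁ = u} {u'} refl refl = cong (λ p → u , u' , p) (ℕP.≡-irrelevant _ _)

splits↔fin : ∀ m → Splits m ↔ Fin (suc m)
splits↔fin m = mk↔ₛ′ to from to∘from from∘to
  where
  open ≡-Reasoning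

  to : Splits m → Fin (suc m)
  to (u , u' , e) = fromℕ< (s≤s (subst (u ℕ.≤_) e (ℕP.m≤m+n u u')))

  from : Fin (suc m) → Splits m
  from i = toℕ i , m ℕ.∸ toℕ i , ℕP.m+[n∸m]≡n (FinP.toℕ≤pred[n] i)

  to∘from : ∀ i → to (from i) ≡ i
  to∘from i = FinP.fromℕ<-toℕ i _

  from∘to : ∀ s → from (to s) ≡ s
  from∘to (u , u' , e) = same-split toℕ-to (begin
    m ℕ.∸ toℕ (to (u , u' , e))  ≡⟨ cong (m ℕ.∸_) toℕ-to ⟩
    m ℕ.∸ u                      ≡⟨ cong (ℕ._∸ u) (sym e) ⟩
    u ℕ.+ u' ℕ.∸ u               ≡⟨ ℕP.m+n∸m≡n u u' ⟩
    u'                           ∎)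
    where
    toℕ-to : toℕ (to (u , u' , e)) ≡ u
    toℕ-to = FinP.toℕ-fromℕ< _

data Compare (u v : ℕ) : Set where
  ≥-by : ∀ k → v ℕ.+ k ≡ u → Compare u v
  <-by : ∀ k → u ℕ.+ suc k ≡ v → Compare u v

compare : ∀ u v → Compare u v
compare u       zero    = ≥-by u refl
compare zero    (suc v) = <-by v refl
compare (suc u) (suc v) with compare u v
... | ≥-by k eq = ≥-by k (cong suc eq)
... | <-by k eq = <-by k (cong suc eq)

compare-≥ : ∀ v k → compare (v ℕ.+ k) v ≡ ≥-by k refl
compare-≥ zero    k = refl
compare-≥ (suc v) k rewrite compare-≥ v k = refl

compare-< : ∀ u k → compare u (u ℕ.+ suc k) ≡ <-by k refl
compare-< zero    k = refl
compare-< (suc u) k rewrite compare-< u k = refl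

-- (x, y, c) ↦ ((x + c⁺, y + c⁻), (x + c⁻, y + c⁺)); the inverse reads c off as the
-- difference of the two first parts, and x as their minimum.
triples↔splits² : ∀ m → Triples m ↔ (Splits m × Splits m)
triples↔splits² m = mk↔ₛ′ to from to∘from from∘to
  where
  open ≡-Reasoning

  to : Triples m → Splits m × Splits m
  to (x , y , + k , e)      = (x ℕ.+ k , y , trans (ℕ-comm.xy∙z≈xz∙y x k y) e)
                            , (x , y ℕ.+ k , trans (sym (ℕP.+-assoc x y k)) e)
  to (x , y , -[1+ k ] , e) = (x , y ℕ.+ suc k , trans (sym (ℕP.+-assoc x y (suc k))) e)
                            , (x ℕ.+ suc k , y , trans (ℕ-comm.xy∙z≈xz∙y x (suc k) y) e)

  from : Splits m × Splits m → Triples m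
  from ((u , u' , e₁) , (v , v' , e₂)) with compare u v
  ... | ≥-by k refl = v , u' , + k , trans (ℕ-comm.xy∙z≈xz∙y v u' k) e₁
  ... | <-by k refl = u , v' , -[1+ k ] , trans (ℕ-comm.xy∙z≈xz∙y u v' (suc k)) e₂

  to∘from : ∀ s → to (from s) ≡ s
  to∘from ((u , u' , e₁) , (v , v' , e₂)) with compare u v
  ... | ≥-by k refl = cong₂ _,_ (same-split refl refl) (same-split refl (ℕP.+-cancelˡ-≡ v _ _ (begin
    v ℕ.+ (u' ℕ.+ k)  ≡⟨ ℕ-comm.x∙yz≈xz∙y v u' k ⟩
    v ℕ.+ k ℕ.+ u'    ≡⟨ trans e₁ (sym e₂) ⟩
    v ℕ.+ v'          ∎)))
  ... | <-by k refl = cong₂ _,_ (same-split refl (ℕP.+-cancelˡ-≡ u _ _ (begin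
    u ℕ.+ (v' ℕ.+ suc k)  ≡⟨ ℕ-comm.x∙yz≈xz∙y u v' (suc k) ⟩
    u ℕ.+ suc k ℕ.+ v'    ≡⟨ trans e₂ (sym e₁) ⟩
    u ℕ.+ u'              ∎))) (same-split refl refl)

  from∘to : ∀ t → from (to t) ≡ t
  from∘to (x , y , + k , e) rewrite compare-≥ x k =
    cong (λ e → x , y , + k , e) (ℕP.≡-irrelevant _ _)
  from∘to (x , y , -[1+ k ] , e) rewrite compare-< x k =
    cong (λ e → x , y , -[1+ k ] , e) (ℕP.≡-irrelevant _ _)

triples↔square : ∀ m → Triples m ↔ Fin (suc m * suc m)
triples↔square m =
  ↔-trans (triples↔splits² m) (↔-trans (splits↔fin m ×-↔ splits↔fin m) (↔-sym FinP.*↔×))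

lemma2 : (n : ℕ) → n ≥ 1 → Edge n ↔ Fin (12 * (n * n))
lemma2 n@(suc m) _ = begin
  Edge n                                          ↔⟨ edges↔displacements ⟩
  (Σ Δ λ δ → Admissible δ × Link n δ)             ↔⟨ Σ-assoc ⟨
  Σ (Σ Δ Admissible) (λ a → Link n (proj₁ a))     ↔⟨ Σ-↔ directions ↔-refl ⟨
  Σ (Fin 6) (λ d → Link n (vector d))             ↔⟨ Σ-↔ ↔-refl (λ {d} → link↔base d) ⟩
  (Fin 6 × Link n (vector 0F))                    ↔⟨ ↔-refl ×-↔ base↔triples m ⟩
  (Fin 6 × (Triples m ⊎ Triples m))               ↔⟨ ↔-refl ×-↔ (triples↔square m ⊎-↔ triples↔square m) ⟩
  (Fin 6 × (Fin (n * n) ⊎ Fin (n * n)))           ↔⟨ ↔-trans FinP.*↔× (↔-refl ×-↔ FinP.+↔⊎) ⟨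
  Fin (6 * (n * n ℕ.+ n * n))                     ≡⟨ cong Fin (six-doubles (n * n)) ⟩
  Fin (12 * (n * n))                              ∎
  where
  open Related.EquationalReasoning
  six-doubles : ∀ k → 6 * (k ℕ.+ k) ≡ 12 * k
  six-doubles = ℕSolver.solve-∀
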